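{- The class of acyclic binary CSP instances is not equal to $\mathrm{CSP}_{SP}(\mathcal{S})$ for any finite set of patterns $\mathcal{S}$.
   Context: A binary CSP instance is a triple $\langle V,D,C\rangle$: $V$ a finite set of variables, a finite domain $D(v)$ for each $v\in V$, and for each ordered pair of distinct variables $(u,v)$ a relation $R_{uv}\subseteq D(u)\times D(v)$, with $R_{vu}=\{(b,a):(a,b)\in R_{uv}\}$. A constraint $R_{uv}$ is trivial if $R_{uv}=D(u)\times D(v)$. The constraint graph of $I$ has vertex set $V$ and an edge $\{u,v\}$ for each non-trivial constraint $R_{uv}$; $I$ is acyclic if its constraint graph is acyclic. A pattern is a structure $\langle X,E^{\sim},E^{+},E^{ - }\rangle$ where $X$ is a set of points, $E^{\sim}$ is an equivalence relation on $X$ whose classes are called parts, and $E^{+}$ (positive edges), $E^{ - }$ (negative edges) are symmetric binary relations on $X$ each disjoint from $E^{\sim}$. For an instance $I$, the pattern $\mathcal{P}(I)$ has points $x_{v,a}$ ($v\in V$, $a\in D(v)$), with $x_{u,a},x_{v,b}$ in the same part iff $u=v$, and for $u\neq v$ the pair $(x_{u,a},x_{v,b})$ is a positive edge if $(a,b)\in R_{uv}$ and a negative edge otherwise. A homomorphism of patterns is a map of points sending same-part pairs to same-part pairs, positive edges to positive edges and negative edges to negative edges; it preserves parts if points in distinct parts are mapped to points in distinct parts. $P_1 \stackrel{SP}{\rightarrow} P_2$ if there is a part-preserving homomorphism $P_1\to P_2$. For a set $\mathcal{S}$ of patterns, $\mathrm{CSP}_{SP}(\mathcal{S})$ is the class of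 binary CSP instances $I$ such that for no $Q\in\mathcal{S}$ do we have $Q \stackrel{SP}{\rightarrow} \mathcal{P}(I)$. -}

module Defs where

open import Data.Nat using (ℕ; suc)
open import Data.Fin using (Fin; zero; suc; inject₁; fromℕ)
open import Data.Bool using (Bool; true; false)
open import Data.Product using (Σ; ∃; ∃-syntax; _×_; _,_)
open import Data.List using (List)
open import Data.List.Relation.Unary.All using (All)
open import Relation.Nullary using (¬_)
open import Relation.Binary.PropositionalEquality using (_≡_; _≢_)
open import Relation.Binary.Definitions using (Symmetric)
open import Relation.Binary.Structures using (IsEquivalence)
open import Function.Definitions using (Injective)
open import Function.Bundles using (_⇔_)

-- Domain of v: Fin (dom v).
-- rel u v : the relation R_uv ⊆ D(u) × D(v), as a (decidable) Boolean
-- predicate; rel-sym encodes R_vu = R_uv⁻¹.  (rel v v is irrelevant.)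

record Instance : Set where
  field
    n       : ℕ
    dom     : Fin n → ℕ
    rel     : (u v : Fin n) → Fin (dom u) → Fin (dom v) → Bool
    rel-sym : ∀ u v a b → rel u v a b ≡ rel v u b a

open Instance public

Edge : (I : Instance) → Fin (n I) → Fin (n I) → Set
Edge I u v = u ≢ v × ∃[ a ] ∃[ b ] (rel I u v a b ≡ false)

record Cycle (I : Instance) : Set where
  field
    k      : ℕ
    c      : Fin (suc (suc (suc k))) → Fin (n I)
    c-inj  : Injective _≡_ _≡_ c
    steps  : ∀ (i : Fin (suc (suc k))) → Edge I (c (inject₁ i)) (c (suc i))
    close  : Edge I (c (fromℕ (suc (suc k)))) (c zero)

Acyclic : Instance → Set
Acyclic I = ¬ Cycle I

record PatternOn (X : Set) : Set₁ where
  field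
    Same  : X → X → Set
    Pos   : X → X → Set
    Neg   : X → X → Set
    Same-equiv : IsEquivalence Same
    Pos-sym    : Symmetric Pos
    Neg-sym    : Symmetric Neg
    Pos-disj   : ∀ {x y} → Pos x y → ¬ Same x y
    Neg-disj   : ∀ {x y} → Neg x y → ¬ Same x y

open PatternOn public

record Pattern : Set₁ where
  field
    size    : ℕ
    structure : PatternOn (Fin size)

open Pattern public

record SPHom {X Y : Set} (P₁ : PatternOn X) (P₂ : PatternOn Y) : Set₁ where
  field
    f        : X → Y
    pres-same : ∀ {x y} → Same P₁ x y → Same P₂ (f x) (f y)
    pres-pos  : ∀ {x y} → Pos P₁ x y → Pos P₂ (f x) (f y)
    pres-neg  : ∀ {x y} → Neg P₁ x y → Neg P₂ (f x) (f y)
    pres-parts : ∀ {x y} → ¬ Same P₁ x y → ¬ Same P₂ (f x) (f y)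

Point : Instance → Set
Point I = Σ (Fin (n I)) (λ v → Fin (dom I v))

data SamePt (I : Instance) : Point I → Point I → Set where
  same : ∀ {v a b} → SamePt I (v , a) (v , b)

data PosPt (I : Instance) : Point I → Point I → Set where
  pos : ∀ {u v a b} → u ≢ v → rel I u v a b ≡ true → PosPt I (u , a) (v , b)

data NegPt (I : Instance) : Point I → Point I → Set where
  neg : ∀ {u v a b} → u ≢ v → rel I u v a b ≡ false → NegPt I (u , a) (v , b)

private
  ≢-sym : ∀ {A : Set} {x y : A} → x ≢ y → y ≢ x
  ≢-sym p q = p (Relation.Binary.PropositionalEquality.sym q)

  open import Relation.Binary.PropositionalEquality using (refl; trans; sym)

  same-refl : ∀ {I} {x : Point I} → SamePt I x x
  same-refl {x = v , a} = same

  same-sym : ∀ {I} {x y : Point I} → SamePt I x y → SamePt I y x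
  same-sym same = same

  same-trans : ∀ {I} {x y z : Point I} → SamePt I x y → SamePt I y z → SamePt I x z
  same-trans same same = same

  pos-sym : ∀ {I} {x y : Point I} → PosPt I x y → PosPt I y x
  pos-sym {I} (pos {u} {v} {a} {b} ne e) = pos (≢-sym ne) (trans (sym (rel-sym I u v a b)) e)

  neg-sym : ∀ {I} {x y : Point I} → NegPt I x y → NegPt I y x
  neg-sym {I} (neg {u} {v} {a} {b} ne e) = neg (≢-sym ne) (trans (sym (rel-sym I u v a b)) e)

  pos-disj : ∀ {I} {x y : Point I} → PosPt I x y → ¬ SamePt I x y
  pos-disj (pos ne _) same = ne refl

  neg-disj : ∀ {I} {x y : Point I} → NegPt I x y → ¬ SamePt I x y
  neg-disj (neg ne _) same = ne refl

𝒫 : (I : Instance) → PatternOn (Point I)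
𝒫 I = record
  { Same = SamePt I
  ; Pos  = PosPt I
  ; Neg  = NegPt I
  ; Same-equiv = record { refl = same-refl ; sym = same-sym ; trans = same-trans }
  ; Pos-sym = pos-sym
  ; Neg-sym = neg-sym
  ; Pos-disj = pos-disj
  ; Neg-disj = neg-disj
  }

CSP-SP : List Pattern → Instance → Set₁
CSP-SP S I = All (λ Q → ¬ SPHom (structure Q) (𝒫 I)) S

-- Let C be the cycle of length k + 3 with unit domains and the empty relation between
-- neighbours, where k bounds the number of points of every pattern in S.  A
-- part-preserving homomorphism of a pattern of S into 𝒫(C) misses some variable w, so
-- it is also one into 𝒫 of C with every constraint at w made trivial.  That instance is
-- a path, hence acyclic, hence in CSP_SP(S); so no pattern of S maps into 𝒫(C) either,
-- and C would have to be acyclic.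
module Submission where

open import Defs
open import Data.Bool using (true; false; not; _∨_)
open import Data.Bool.Properties using (not-injective; ∨-comm; ∨-zeroʳ; ∨-conicalˡ; ∨-conicalʳ)
open import Data.Fin using (Fin; zero; suc; toℕ; inject₁; fromℕ; _≟_)
open import Data.Fin.Properties
  using (toℕ-injective; toℕ-inject₁; toℕ-fromℕ; toℕ<n; toℕ≤pred[n]; injective⇒≤; ¬∀⟶∃¬; any?)
open import Data.List using (List; map; _∷_; allFin)
open import Data.List.Extrema.Nat using (argmax; f[xs]≤f[argmax])
open import Data.List.Membership.Propositional using (_∈_)
open import Data.List.Membership.Propositional.Properties using (∈-map⁺; ∈-allFin)
open import Data.List.Relation.Unary.All as All using (tabulate)
open import Data.List.Relation.Unary.Any using (here; there)
open import Data.Nat as ℕ using (ℕ; zero; suc; _+_; _∸_; _≤_; _<_; s≤s; _<?_)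
open import Data.Nat.ListAction using (sum)
open import Data.Nat.Properties
  using (+-∸-assoc; ∸-cancelʳ-≡; +-cancelʳ-≡; ∸-monoˡ-<; ≤-trans; ≤-antisym; <-trans; m≤m+n;
         m≤n+m; ≮⇒≥; n<1+n; m<n⇒m<1+n; <⇒≢; <⇒≱; 1+n≰n; 1+n≢n; suc-injective)
open import Data.Product using (_×_; ∃; _,_; proj₁; proj₂; map₂)
open import Data.Sum as Sum using (_⊎_; inj₁; inj₂; swap)
open import Function using (id; _∘_; mk⇔)
open import Function.Definitions using (Injective)
open import Relation.Binary.PropositionalEquality using (_≡_; _≢_; refl; sym; trans; cong; cong₂)
open import Relation.Nullary using (¬_; Dec; yes; no; does; contradiction)
open import Relation.Nullary.Decidable using (_⊎-dec_; _×-dec_; dec-true; dec-false; does-⇔)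

∈⇒≤sum : ∀ {m ms} → m ∈ ms → m ≤ sum ms
∈⇒≤sum {ms = m ∷ ms} (here refl)  = m≤m+n m (sum ms)
∈⇒≤sum {ms = n ∷ _}  (there m∈ms) = ≤-trans (∈⇒≤sum m∈ms) (m≤n+m _ n)

<⇒missesPoint : ∀ {m n} → m < n → (g : Fin m → Fin n) → ∃ λ w → ∀ i → g i ≢ w
<⇒missesPoint {n = n} m<n g =
  map₂ (λ notInImage i gi≡w → notInImage (i , gi≡w))
       (¬∀⟶∃¬ n (λ w → ∃ λ i → g i ≡ w) (λ w → any? λ i → g i ≟ w) notSurjective)
  where
  notSurjective : ¬ (∀ w → ∃ λ i → g i ≡ w)
  notSurjective preimage = <⇒≱ m<n (injective⇒≤ {f = proj₁ ∘ preimage} λ {w} {w′} eq →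
    trans (sym (proj₂ (preimage w))) (trans (cong g eq) (proj₂ (preimage w′))))

does-true⇒ : ∀ {A : Set} (a? : Dec A) → does a? ≡ true → A
does-true⇒ (yes a) _ = a

does-false⇒¬ : ∀ {A : Set} (a? : Dec A) → does a? ≡ false → ¬ A
does-false⇒¬ a? does≡false x = contradiction (trans (sym (dec-true a? x)) does≡false) λ ()

Consecutive : ℕ → ℕ → Set
Consecutive x y = y ≡ suc x ⊎ x ≡ suc y

consecutive-below : ∀ {a m} → a ≤ m → Consecutive a m → m ≡ suc a
consecutive-below _   (inj₁ m≡1+a) = m≡1+a
consecutive-below a≤m (inj₂ refl)  = contradiction a≤m 1+n≰n

consecutive-below-max : ∀ {a b m} → a ≤ m → b ≤ m → Consecutive a m → Consecutive b m → a ≡ b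
consecutive-below-max a≤m b≤m a~m b~m =
  suc-injective (trans (sym (consecutive-below a≤m a~m)) (consecutive-below b≤m b~m))

maximum : ∀ {n} (g : Fin (suc n) → ℕ) → ∃ λ j → ∀ i → g i ≤ g j
maximum g = argmax g zero (allFin _) ,
  λ i → All.lookup (f[xs]≤f[argmax] {f = g} zero (allFin _)) (∈-allFin i)

fromℕ-or-inject₁ : ∀ {n} (i : Fin (suc n)) → i ≡ fromℕ n ⊎ ∃ λ j → i ≡ inject₁ j
fromℕ-or-inject₁ {zero}  zero    = inj₁ refl
fromℕ-or-inject₁ {suc n} zero    = inj₂ (zero , refl)
fromℕ-or-inject₁ {suc n} (suc i) with fromℕ-or-inject₁ i
... | inj₁ refl       = inj₁ refl
... | inj₂ (j , refl) = inj₂ (suc j , refl)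

UnitStepCycle : ∀ {k} → (Fin (3 + k) → ℕ) → Set
UnitStepCycle {k} g =
  (∀ i → Consecutive (g (inject₁ i)) (g (suc i))) × Consecutive (g (fromℕ (2 + k))) (g zero)

-- The two cycle-neighbours of a maximal position both carry the maximum minus one,
-- and they are distinct positions because the cycle has length ≥ 3.
unitStepCycle⇒noMaximum : ∀ {k} {g : Fin (3 + k) → ℕ} → UnitStepCycle g →
  Injective _≡_ _≡_ g → ∀ j → ¬ (∀ i → g i ≤ g j)
unitStepCycle⇒noMaximum {k} (step , close) inj zero g≤ =
  contradiction
    (inj (consecutive-below-max (g≤ (suc zero)) (g≤ (fromℕ (2 + k))) (swap (step zero)) close))
    λ ()
unitStepCycle⇒noMaximum (step , close) inj (suc i) g≤ with fromℕ-or-inject₁ i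
... | inj₁ refl =
  contradiction (inj (consecutive-below-max (g≤ (inject₁ i)) (g≤ zero) (step i) (swap close))) λ ()
... | inj₂ (j , refl) =
  contradiction
    (inj (consecutive-below-max (g≤ (inject₁ (inject₁ j))) (g≤ (suc (suc j)))
                                (step (inject₁ j)) (swap (step (suc j)))))
    neighbours-distinct
  where
  neighbours-distinct : inject₁ (inject₁ j) ≢ suc (suc j)
  neighbours-distinct eq = <⇒≢ (m<n⇒m<1+n (n<1+n (toℕ j)))
    (trans (sym (trans (toℕ-inject₁ (inject₁ j)) (toℕ-inject₁ j))) (cong toℕ eq))

unitStepLabelling⇒acyclic : (I : Instance) (ℓ : Fin (n I) → ℕ) → Injective _≡_ _≡_ ℓ →
  (∀ {u v} → Edge I u v → Consecutive (ℓ u) (ℓ v)) → Acyclic I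
unitStepLabelling⇒acyclic I ℓ ℓ-injective edge⇒consecutive cycle =
  unitStepCycle⇒noMaximum {g = ℓ ∘ c}
    ((λ i → edge⇒consecutive (steps i)) , edge⇒consecutive close)
    (c-inj ∘ ℓ-injective) (proj₁ (maximum (ℓ ∘ c))) (proj₂ (maximum (ℓ ∘ c)))
  where open Cycle cycle

isolate : (I : Instance) → Fin (n I) → Instance
isolate I w = record I
  { rel     = λ u v a b → (does (u ≟ w) ∨ does (v ≟ w)) ∨ rel I u v a b
  ; rel-sym = λ u v a b → cong₂ _∨_ (∨-comm (does (u ≟ w)) _) (rel-sym I u v a b)
  }

isolate-edge : ∀ {I w u v} → Edge (isolate I w) u v → Edge I u v × u ≢ w × v ≢ w
isolate-edge {w = w} {u} {v} (u≢v , a , b , nontrivial) =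
  (u≢v , a , b , ∨-conicalʳ _ _ nontrivial) ,
  does-false⇒¬ (u ≟ w) (∨-conicalˡ _ _ not-incident) ,
  does-false⇒¬ (v ≟ w) (∨-conicalʳ _ _ not-incident)
  where not-incident = ∨-conicalˡ _ _ nontrivial

module _ {I : Instance} {w : Fin (n I)} where

  isolate-same : ∀ {x y} → SamePt I x y → SamePt (isolate I w) x y
  isolate-same same = same

  isolate-same⁻ : ∀ {x y} → SamePt (isolate I w) x y → SamePt I x y
  isolate-same⁻ same = same

  isolate-pos : ∀ {x y} → PosPt I x y → PosPt (isolate I w) x y
  isolate-pos (pos u≢v allowed) = pos u≢v (trans (cong (_ ∨_) allowed) (∨-zeroʳ _))

  isolate-neg : ∀ {x y} → proj₁ x ≢ w → proj₁ y ≢ w → NegPt I x y → NegPt (isolate I w) x y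
  isolate-neg {u , _} {v , _} u≢w v≢w (neg u≢v forbidden) =
    neg u≢v (trans (cong₂ (λ p q → (p ∨ q) ∨ _) (dec-false (u ≟ w) u≢w) (dec-false (v ≟ w) v≢w))
                   forbidden)

  isolate-hom : ∀ {X} {P : PatternOn X} (h : SPHom P (𝒫 I)) →
    (∀ x → proj₁ (SPHom.f h x) ≢ w) → SPHom P (𝒫 (isolate I w))
  isolate-hom h avoids-w = record
    { f          = f
    ; pres-same  = isolate-same ∘ pres-same
    ; pres-pos   = isolate-pos ∘ pres-pos
    ; pres-neg   = λ {x} {y} → isolate-neg (avoids-w x) (avoids-w y) ∘ pres-neg
    ; pres-parts = λ ¬same → pres-parts ¬same ∘ isolate-same⁻
    }
    where open SPHom h

-- A pattern with fewer points than I has variables misses a part of 𝒫(I).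
CSP-SP-isolate⁻ : (S : List Pattern) (I : Instance) → (∀ {Q} → Q ∈ S → size Q < n I) →
  (∀ w → CSP-SP S (isolate I w)) → CSP-SP S I
CSP-SP-isolate⁻ S I small isolated = tabulate λ {Q} Q∈S h →
  let w , misses-w = <⇒missesPoint (small Q∈S) (proj₁ ∘ SPHom.f h)
  in All.lookup (isolated w) Q∈S (isolate-hom h misses-w)

CycleSucc : ℕ → ℕ → ℕ → Set
CycleSucc m x y = y ≡ suc x ⊎ x ≡ m × y ≡ 0

CycleAdjacent : ℕ → ℕ → ℕ → Set
CycleAdjacent m x y = CycleSucc m x y ⊎ CycleSucc m y x

cycleSucc? : ∀ m x y → Dec (CycleSucc m x y)
cycleSucc? m x y = y ℕ.≟ suc x ⊎-dec x ℕ.≟ m ×-dec y ℕ.≟ 0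

cycleAdjacent? : ∀ m x y → Dec (CycleAdjacent m x y)
cycleAdjacent? m x y = cycleSucc? m x y ⊎-dec cycleSucc? m y x

cycleSucc-irreflexive : ∀ {m x y} → CycleSucc (suc m) x y → x ≢ y
cycleSucc-irreflexive (inj₁ refl)         = 1+n≢n ∘ sym
cycleSucc-irreflexive (inj₂ (refl , refl)) = λ ()

cycleCSP : ℕ → Instance
cycleCSP k = record
  { n       = 3 + k
  ; dom     = λ _ → 1
  ; rel     = λ u v _ _ → not (does (cycleAdjacent? (2 + k) (toℕ u) (toℕ v)))
  ; rel-sym = λ u v _ _ → cong not
      (does-⇔ (mk⇔ swap swap) (cycleAdjacent? _ (toℕ u) (toℕ v))
                              (cycleAdjacent? _ (toℕ v) (toℕ u)))
  }

module _ {k : ℕ} {u v : Fin (3 + k)} where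

  cycleCSP-edge⁺ : CycleSucc (2 + k) (toℕ u) (toℕ v) → Edge (cycleCSP k) u v
  cycleCSP-edge⁺ u→v =
    cycleSucc-irreflexive u→v ∘ cong toℕ , zero , zero ,
    cong not (dec-true (cycleAdjacent? _ _ _) (inj₁ u→v))

  cycleCSP-edge⁻ : Edge (cycleCSP k) u v → CycleAdjacent (2 + k) (toℕ u) (toℕ v)
  cycleCSP-edge⁻ (_ , _ , _ , nontrivial) =
    does-true⇒ (cycleAdjacent? _ _ _) (not-injective nontrivial)

cycleCSP-cycle : ∀ k → Cycle (cycleCSP k)
cycleCSP-cycle k = record
  { k     = k
  ; c     = id
  ; c-inj = id
  ; steps = λ i → cycleCSP-edge⁺ (inj₁ (cong suc (sym (toℕ-inject₁ i))))
  ; close = cycleCSP-edge⁺ (inj₂ (toℕ-fromℕ (2 + k) , refl))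
  }

-- Position of x on the path w + 1, …, N − 1, 0, …, w − 1 that remains of the cycle
-- 0 → 1 → ⋯ → N − 1 → 0 when w is removed.
pathPosition : (N w x : ℕ) → ℕ
pathPosition N w x with w <? x
... | yes _ = x ∸ suc w
... | no  _ = x + (N ∸ suc w)

∸-suc : ∀ {w x} → w < x → x ∸ w ≡ suc (x ∸ suc w)
∸-suc (s≤s w≤x) = +-∸-assoc 1 w≤x

pathPosition-injective : ∀ {N w x y} → x < N → y < N →
  pathPosition N w x ≡ pathPosition N w y → x ≡ y
pathPosition-injective {N} {w} {x} {y} x<N y<N eq with w <? x | w <? y
... | yes w<x | yes w<y = ∸-cancelʳ-≡ w<x w<y eq
... | no _    | no _    = +-cancelʳ-≡ (N ∸ suc w) x y eq
... | yes w<x | no _    = contradiction eq (<⇒≢ (≤-trans (∸-monoˡ-< x<N w<x) (m≤n+m _ y)))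
... | no _    | yes w<y = contradiction (sym eq) (<⇒≢ (≤-trans (∸-monoˡ-< y<N w<y) (m≤n+m _ x)))

pathPosition-suc : ∀ {N w x} → x ≢ w → pathPosition N w (suc x) ≡ suc (pathPosition N w x)
pathPosition-suc {w = w} {x} x≢w with w <? x | w <? suc x
... | yes w<x | yes _    = ∸-suc w<x
... | yes w<x | no w≮1+x = contradiction (<-trans w<x (n<1+n x)) w≮1+x
... | no w≮x  | yes w<1+x = contradiction (≤-antisym (≮⇒≥ w≮x) (ℕ.s≤s⁻¹ w<1+x)) x≢w
... | no _    | no _     = refl

pathPosition-wrap : ∀ {m w} → w ≤ m → m ≢ w →
  pathPosition (suc m) w 0 ≡ suc (pathPosition (suc m) w m)
pathPosition-wrap {m} {w} w≤m m≢w with w <? m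
... | yes w<m = ∸-suc w<m
... | no w≮m  = contradiction (≤-antisym (≮⇒≥ w≮m) w≤m) m≢w

pathPosition-step : ∀ {m w x y} → w ≤ m → x ≢ w → CycleSucc m x y →
  pathPosition (suc m) w y ≡ suc (pathPosition (suc m) w x)
pathPosition-step _   x≢w (inj₁ refl)         = pathPosition-suc x≢w
pathPosition-step w≤m x≢w (inj₂ (refl , refl)) = pathPosition-wrap w≤m x≢w

isolate-cycleCSP-acyclic : ∀ k w → Acyclic (isolate (cycleCSP k) w)
isolate-cycleCSP-acyclic k w =
  unitStepLabelling⇒acyclic (isolate (cycleCSP k) w) position position-injective position-step
  where
  position : Fin (3 + k) → ℕ
  position u = pathPosition (3 + k) (toℕ w) (toℕ u)

  position-injective : Injective _≡_ _≡_ position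
  position-injective = toℕ-injective ∘ pathPosition-injective (toℕ<n _) (toℕ<n _)

  position-step : ∀ {u v} → Edge (isolate (cycleCSP k) w) u v →
    Consecutive (position u) (position v)
  position-step e with e′ , u≢w , v≢w ← isolate-edge {cycleCSP k} e =
    Sum.map (pathPosition-step (toℕ≤pred[n] w) (u≢w ∘ toℕ-injective))
            (pathPosition-step (toℕ≤pred[n] w) (v≢w ∘ toℕ-injective))
            (cycleCSP-edge⁻ e′)

corollary4p4 : (S : List Pattern) →
    ¬ (∀ (I : Instance) → (Acyclic I → CSP-SP S I) × (CSP-SP S I → Acyclic I))
corollary4p4 S characterisation = proj₂ (characterisation C) C∈CSP-SP (cycleCSP-cycle k)
  where
  k : ℕ
  k = sum (map size S)

  C : Instance
  C = cycleCSP k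

  smaller-than-C : ∀ {Q} → Q ∈ S → size Q < n C
  smaller-than-C Q∈S = s≤s (≤-trans (∈⇒≤sum (∈-map⁺ size Q∈S)) (m≤n+m k 2))

  C∈CSP-SP : CSP-SP S C
  C∈CSP-SP = CSP-SP-isolate⁻ S C smaller-than-C λ w →
    proj₁ (characterisation (isolate C w)) (isolate-cycleCSP-acyclic k w)
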